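{- Let $N$ and $d$ be positive integers with $d \mid N$. Then the set $$A = \{a \in \mathbb{Z}_N : a \equiv 1,2,\ldots,d-1 \pmod d\}$$ is $d$-cube-free, and it has size $\frac{d-1}{d}N$.
   Context: Since $d \mid N$, reduction modulo $d$ is well defined on $\mathbb{Z}_N$. For a multiset $S = \{a_1,\ldots,a_d\}$ of $d$ elements of $\mathbb{Z}_N$, the projective $d$-cube generated by $S$ is $\Sigma^*S = \{\sum_{i\in I} a_i : \varnothing \neq I \subseteq [d]\}$. A set $A \subseteq \mathbb{Z}_N$ is $d$-cube-free if there is no multiset $S$ of size $d$ with $\Sigma^*S \subseteq A$. -}

module Defs where

open import Data.Nat using (ℕ; zero; suc; _+_; _*_; _∸_; NonZero)
open import Data.Nat.DivMod using (_%_; _/_)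
open import Data.Fin using (Fin; toℕ; fromℕ<)
open import Data.Fin.Subset using (Subset; _∈_; Nonempty)
open import Data.Nat.DivMod using (m%n<n)
open import Data.Vec using (tabulate)
open import Data.Bool using (Bool; true; false; if_then_else_)
open import Data.Product using (∃)
open import Relation.Nullary using (¬_; does)
open import Relation.Binary.PropositionalEquality using (_≡_)
open import Data.Nat using (_≟_)

-- Z_N is represented by Fin N (residues 0..N-1); N must be nonzero.

toZ : (N : ℕ) → .{{_ : NonZero N}} → ℕ → Fin N
toZ N m = fromℕ< (m%n<n m N)

sumℕ : ∀ {d N} → (Fin d → Fin N) → Subset d → ℕ
sumℕ {zero}  a _ = 0
sumℕ {suc d} a (b Data.Vec.∷ I) =
  (if b then toℕ (a Data.Fin.zero) else 0) + sumℕ (λ i → a (Data.Fin.suc i)) I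

subsetSum : ∀ {d N} .{{_ : NonZero N}} → (Fin d → Fin N) → Subset d → Fin N
subsetSum {N = N} a I = toZ N (sumℕ a I)

ZSet : ℕ → Set
ZSet N = Subset N

-- Σ*S ⊆ A, for the multiset S = {a_1,…,a_d} given as a d-tuple a
cubeIn : (d N : ℕ) .{{_ : NonZero N}} → (Fin d → Fin N) → ZSet N → Set
cubeIn d N a A = ∀ (I : Subset d) → Nonempty I → subsetSum a I ∈ A

CubeFree : (d N : ℕ) .{{_ : NonZero N}} → ZSet N → Set
CubeFree d N A = ¬ ∃ λ (a : Fin d → Fin N) → cubeIn d N a A

nonzeroModSet : (N d : ℕ) .{{_ : NonZero d}} → ZSet N
nonzeroModSet N d = tabulate λ (x : Fin N) → if does (toℕ x % d ≟ 0) then false else true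

{-# OPTIONS --safe #-}
-- Among the d + 1 prefix sums a₁ + … + aₖ (0 ≤ k ≤ d) two agree modulo d, so some nonempty
-- block a_{i+1} + … + a_j of consecutive elements is divisible by d. That block is an element
-- of Σ*S which is 0 modulo d (reduction mod N preserves residues mod d since d ∣ N), hence
-- not in A. The size count is periodic with period d, and each period has d − 1 elements of A.
module Submission where

open import Defs
open import Data.Nat using (ℕ; _*_; _∸_; NonZero)
open import Data.Nat.DivMod using (_/_)
open import Data.Nat.Divisibility using (_∣_)
open import Data.Fin.Subset using (∣_∣)
open import Data.Product using (_×_)
open import Relation.Binary.PropositionalEquality using (_≡_)

open import Data.Nat as ℕ using (zero; suc; _+_; _≤_; _<_; _≤?_; _<?_; _≟_; z≤n; s≤s)
open import Data.Nat.Properties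
open import Data.Nat.DivMod using (_%_; m%n<n; m≡m%n+[m/n]*n; m∣n⇒o%n%m≡o%m; [m+n]%n≡m%n; m<n⇒m%n≡m; m*n/n≡m)
open import Data.Nat.Divisibility using (divides; ∣m+n∣m⇒∣n; n∣m⇒m%n≡0)
open import Data.Fin as F using (Fin; toℕ; fromℕ<)
open import Data.Fin.Properties using (pigeonhole; toℕ-fromℕ<; toℕ<n)
open import Data.Fin.Subset using (Subset; Nonempty; _∈_)
open import Data.Vec using (tabulate; lookup)
open import Data.Vec.Properties using (lookup∘tabulate; []=⇒lookup; lookup⇒[]=)
open import Data.Bool using (Bool; true; false; if_then_else_; _∧_)
open import Data.Product using (∃₂; _,_)
open import Relation.Nullary using (does; yes; no)
open import Relation.Nullary.Decidable using (dec-true; dec-false)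
open import Relation.Binary.PropositionalEquality using (refl; sym; trans; cong; cong₂; _≢_; module ≡-Reasoning)
open import Function using (_∘_)

open import Algebra.Properties.CommutativeMonoid.Sum +-0-commutativeMonoid
  using (sum; sum-cong-≗; ∑-distrib-+)

open ≡-Reasoning

sum-const : ∀ n c → sum {n} (λ _ → c) ≡ n * c
sum-const zero    c = refl
sum-const (suc n) c = cong (c +_) (sum-const n c)

sum-+-toℕ : ∀ m n (f : ℕ → ℕ) →
  sum {m + n} (f ∘ toℕ) ≡ sum {m} (f ∘ toℕ) + sum {n} (λ t → f (m + toℕ t))
sum-+-toℕ zero    n f = refl
sum-+-toℕ (suc m) n f =
  trans (cong (f 0 +_) (sum-+-toℕ m n (f ∘ suc))) (sym (+-assoc (f 0) _ _))

sum-periodic : ∀ d (f : ℕ → ℕ) → (∀ x → f (d + x) ≡ f x) →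
  ∀ q → sum {q * d} (f ∘ toℕ) ≡ q * sum {d} (f ∘ toℕ)
sum-periodic d f periodic zero    = refl
sum-periodic d f periodic (suc q) = begin
  sum {d + q * d} (f ∘ toℕ)                             ≡⟨ sum-+-toℕ d (q * d) f ⟩
  sum {d} (f ∘ toℕ) + sum {q * d} (λ t → f (d + toℕ t)) ≡⟨ cong (sum {d} (f ∘ toℕ) +_) shift ⟩
  sum {d} (f ∘ toℕ) + sum {q * d} (f ∘ toℕ)             ≡⟨ cong (sum {d} (f ∘ toℕ) +_) (sum-periodic d f periodic q) ⟩
  sum {d} (f ∘ toℕ) + q * sum {d} (f ∘ toℕ)             ∎
  where
  shift : sum {q * d} (λ t → f (d + toℕ t)) ≡ sum {q * d} (f ∘ toℕ)
  shift = sum-cong-≗ {q * d} (λ t → periodic (toℕ t))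

∣tabulate∣≡sum : ∀ {n} (p : Fin n → Bool) → ∣ tabulate p ∣ ≡ sum (λ t → if p t then 1 else 0)
∣tabulate∣≡sum {zero}  p = refl
∣tabulate∣≡sum {suc n} p with p F.zero
... | true  = cong suc (∣tabulate∣≡sum (p ∘ F.suc))
... | false = ∣tabulate∣≡sum (p ∘ F.suc)

inInterval : ℕ → ℕ → ℕ → Bool
inInterval i j x = does (i ≤? x) ∧ does (x <? j)

interval : ∀ {n} → ℕ → ℕ → Subset n
interval i j = tabulate (inInterval i j ∘ toℕ)

intervalSum : ∀ {n} → (Fin n → ℕ) → ℕ → ℕ → ℕ
intervalSum w i j = sum (λ t → if inInterval i j (toℕ t) then w t else 0)

inInterval-split : ∀ {i j k} → i ≤ j → j ≤ k → ∀ x v →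
  (if inInterval i k x then v else 0) ≡ (if inInterval i j x then v else 0) + (if inInterval j k x then v else 0)
inInterval-split {i} {j} {k} i≤j j≤k x v with x <? j
... | yes x<j
  rewrite dec-true (x <? j) x<j | dec-false (j ≤? x) (<⇒≱ x<j) | dec-true (x <? k) (<-≤-trans x<j j≤k)
  = sym (+-identityʳ _)
... | no x≮j
  rewrite dec-false (x <? j) x≮j | dec-true (j ≤? x) (≮⇒≥ x≮j) | dec-true (i ≤? x) (≤-trans i≤j (≮⇒≥ x≮j))
  = refl

intervalSum-split : ∀ {n} (w : Fin n → ℕ) {i j k} → i ≤ j → j ≤ k →
  intervalSum w i k ≡ intervalSum w i j + intervalSum w j k
intervalSum-split {n} w {i} {j} {k} i≤j j≤k =
  trans (sum-cong-≗ {n} (λ t → inInterval-split i≤j j≤k (toℕ t) (w t)))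
        (∑-distrib-+ (λ t → if inInterval i j (toℕ t) then w t else 0)
                     (λ t → if inInterval j k (toℕ t) then w t else 0))

interval-nonempty : ∀ {n i j} → i < j → j ≤ n → Nonempty (interval {n} i j)
interval-nonempty {n} {i} {j} i<j j≤n = x , lookup⇒[]= x (interval i j) (begin
  lookup (interval i j) x  ≡⟨ lookup∘tabulate (inInterval i j ∘ toℕ) x ⟩
  inInterval i j (toℕ x)   ≡⟨ cong (inInterval i j) (toℕ-fromℕ< i<n) ⟩
  inInterval i j i         ≡⟨ cong₂ _∧_ (dec-true (i ≤? i) ≤-refl) (dec-true (i <? j) i<j) ⟩
  true                     ∎)
  where
  i<n = <-≤-trans i<j j≤n
  x = fromℕ< i<n

toℕ-toZ : ∀ N .{{_ : NonZero N}} m → toℕ (toZ N m) ≡ m % N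
toℕ-toZ N m = toℕ-fromℕ< (m%n<n m N)

m%o≡[m+n]%o⇒o∣n : ∀ o .{{_ : NonZero o}} m n → m % o ≡ (m + n) % o → o ∣ n
m%o≡[m+n]%o⇒o∣n o m n eq = ∣m+n∣m⇒∣n (divides ((m + n) / o) quotients) (divides (m / o) refl)
  where
  quotients : m / o * o + n ≡ (m + n) / o * o
  quotients = +-cancelˡ-≡ (m % o) _ _ (begin
    m % o + (m / o * o + n)       ≡⟨ sym (+-assoc (m % o) _ n) ⟩
    m % o + m / o * o + n         ≡⟨ cong (_+ n) (sym (m≡m%n+[m/n]*n m o)) ⟩
    m + n                         ≡⟨ m≡m%n+[m/n]*n (m + n) o ⟩
    (m + n) % o + (m + n) / o * o ≡⟨ cong (_+ (m + n) / o * o) (sym eq) ⟩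
    m % o + (m + n) / o * o       ∎)

zeroSumInterval : ∀ {n} m .{{_ : NonZero m}} → m ≤ n → (w : Fin n → ℕ) →
  ∃₂ λ i j → i < j × j ≤ n × m ∣ intervalSum w i j
zeroSumInterval {n} m m≤n w = fromCollision (pigeonhole (s≤s m≤n) prefix)
  where
  prefix : Fin (suc n) → Fin m
  prefix k = toZ m (intervalSum w 0 (toℕ k))

  fromCollision : (∃₂ λ i j → i F.< j × prefix i ≡ prefix j) →
    ∃₂ λ i j → i < j × j ≤ n × m ∣ intervalSum w i j
  fromCollision (i , j , i<j , prefixᵢ≡prefixⱼ) =
    toℕ i , toℕ j , i<j , ℕ.s≤s⁻¹ (toℕ<n j) , m%o≡[m+n]%o⇒o∣n m _ _ (begin
      intervalSum w 0 (toℕ i) % m   ≡⟨ sym (toℕ-toZ m _) ⟩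
      toℕ (prefix i)                ≡⟨ cong toℕ prefixᵢ≡prefixⱼ ⟩
      toℕ (prefix j)                ≡⟨ toℕ-toZ m _ ⟩
      intervalSum w 0 (toℕ j) % m   ≡⟨ cong (_% m) (intervalSum-split w z≤n (<⇒≤ i<j)) ⟩
      (intervalSum w 0 (toℕ i) + intervalSum w (toℕ i) (toℕ j)) % m ∎)

sumℕ-tabulate : ∀ {d N} (a : Fin d → Fin N) (p : Fin d → Bool) →
  sumℕ a (tabulate p) ≡ sum (λ t → if p t then toℕ (a t) else 0)
sumℕ-tabulate {zero}  a p = refl
sumℕ-tabulate {suc d} a p =
  cong ((if p F.zero then toℕ (a F.zero) else 0) +_) (sumℕ-tabulate (a ∘ F.suc) (p ∘ F.suc))

isNonzero : ℕ → Bool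
isNonzero r = if does (r ≟ 0) then false else true

isNonzeroMod : (d : ℕ) .{{_ : NonZero d}} → ℕ → Bool
isNonzeroMod d x = isNonzero (x % d)

∈nonzeroModSet⇒%≢0 : ∀ {N d} .{{_ : NonZero d}} {x : Fin N} →
  x ∈ nonzeroModSet N d → toℕ x % d ≢ 0
∈nonzeroModSet⇒%≢0 {N} {d} {x} x∈A x%d≡0 with () ← begin
  false                              ≡⟨ cong isNonzero (sym x%d≡0) ⟩
  isNonzeroMod d (toℕ x)             ≡⟨ sym (lookup∘tabulate (isNonzeroMod d ∘ toℕ) x) ⟩
  lookup (nonzeroModSet N d) x       ≡⟨ []=⇒lookup x∈A ⟩
  true                               ∎

nonzeroModSet-cubeFree : ∀ N d .{{_ : NonZero N}} .{{_ : NonZero d}} → d ∣ N →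
  CubeFree d N (nonzeroModSet N d)
nonzeroModSet-cubeFree N d d∣N (a , cube) with zeroSumInterval d ≤-refl (toℕ ∘ a)
... | i , j , i<j , j≤d , d∣block =
  ∈nonzeroModSet⇒%≢0 (cube (interval i j) (interval-nonempty i<j j≤d)) (begin
    toℕ (subsetSum a (interval i j)) % d ≡⟨ cong (_% d) (toℕ-toZ N _) ⟩
    sumℕ a (interval i j) % N % d        ≡⟨ m∣n⇒o%n%m≡o%m d N _ d∣N ⟩
    sumℕ a (interval i j) % d            ≡⟨ cong (_% d) (sumℕ-tabulate a (inInterval i j ∘ toℕ)) ⟩
    intervalSum (toℕ ∘ a) i j % d        ≡⟨ n∣m⇒m%n≡0 _ d d∣block ⟩
    0                                    ∎)

nonzeroIndicator : ℕ → ℕ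
nonzeroIndicator r = if isNonzero r then 1 else 0

nonzeroModIndicator : (d : ℕ) .{{_ : NonZero d}} → ℕ → ℕ
nonzeroModIndicator d x = nonzeroIndicator (x % d)

nonzeroModIndicator-periodic : ∀ d .{{_ : NonZero d}} x →
  nonzeroModIndicator d (d + x) ≡ nonzeroModIndicator d x
nonzeroModIndicator-periodic d x =
  cong nonzeroIndicator (trans (cong (_% d) (+-comm d x)) ([m+n]%n≡m%n x d))

sum-nonzeroModIndicator-period : ∀ d' → sum {suc d'} (nonzeroModIndicator (suc d') ∘ toℕ) ≡ d'
sum-nonzeroModIndicator-period d' = begin
  sum {suc d'} (nonzeroModIndicator (suc d') ∘ toℕ)           ≡⟨⟩
  sum {d'} (λ t → nonzeroModIndicator (suc d') (suc (toℕ t))) ≡⟨ sum-cong-≗ {d'} isOne ⟩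
  sum {d'} (λ _ → 1)                                          ≡⟨ sum-const d' 1 ⟩
  d' * 1                                                      ≡⟨ *-identityʳ d' ⟩
  d'                                                          ∎
  where
  isOne : ∀ t → nonzeroModIndicator (suc d') (suc (toℕ t)) ≡ 1
  isOne t = cong nonzeroIndicator (m<n⇒m%n≡m (s≤s (toℕ<n t)))

nonzeroModSet-size : ∀ N d .{{_ : NonZero N}} .{{_ : NonZero d}} → d ∣ N →
  ∣ nonzeroModSet N d ∣ ≡ ((d ∸ 1) * N) / d
nonzeroModSet-size N d@(suc d') (divides q refl) = begin
  ∣ nonzeroModSet (q * d) d ∣                   ≡⟨ ∣tabulate∣≡sum {q * d} (isNonzeroMod d ∘ toℕ) ⟩
  sum {q * d} (nonzeroModIndicator d ∘ toℕ)     ≡⟨ sum-periodic d _ (nonzeroModIndicator-periodic d) q ⟩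
  q * sum {d} (nonzeroModIndicator d ∘ toℕ)     ≡⟨ cong (q *_) (sum-nonzeroModIndicator-period d') ⟩
  q * d'                                        ≡⟨ *-comm q d' ⟩
  d' * q                                        ≡⟨ m*n/n≡m (d' * q) d ⟨
  d' * q * d / d                                ≡⟨ cong (_/ d) (*-assoc d' q d) ⟩
  d' * (q * d) / d                              ∎

mainTheorem2 : (N d : ℕ) .{{_ : NonZero N}} .{{_ : NonZero d}} → d ∣ N →
    CubeFree d N (nonzeroModSet N d) × ∣ nonzeroModSet N d ∣ ≡ ((d ∸ 1) * N) / d
mainTheorem2 N d d∣N = nonzeroModSet-cubeFree N d d∣N , nonzeroModSet-size N d d∣N
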